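{- Let $n$ be an even positive integer and $k$ an integer with $1 \le k \le n-2$. Then \[ R_{n,k} = R_{n-1,k-1} - R_{n-1,k}. \]
   Context: For a permutation $A = a_1a_2\cdots a_n$ of $[n]=\{1,\dots,n\}$, an ascent is an index $i$ ($1 \le i \le n-1$) with $a_i < a_{i+1}$, and an inversion is a pair $(i,j)$ with $1\le i<j\le n$ and $a_i > a_j$; $A$ is even (resp. odd) if its number of inversions is even (resp. odd). A permutation is parity-alternate (a PAP) if its consecutive entries alternate between even and odd integers. Let $\Xi(n,k)$ be the set of PAPs of $[n]$ with exactly $k$ ascents, $P_{n,k}$ the number of even permutations in $\Xi(n,k)$, $Q_{n,k}$ the number of odd ones, and $R_{n,k} = P_{n,k} - Q_{n,k}$. -}

module Defs where

open import Data.Nat using (ℕ; zero; suc; _+_; _<ᵇ_; _≡ᵇ_)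
open import Data.Nat.Properties using ()
open import Data.Bool using (Bool; true; false; _∧_; _xor_; not; if_then_else_)
open import Data.List using (List; []; _∷_; map; concatMap; length; upTo)
open import Data.Integer using (ℤ; +_; _-_)

insertions : ℕ → List ℕ → List (List ℕ)
insertions x [] = (x ∷ []) ∷ []
insertions x (y ∷ ys) = (x ∷ y ∷ ys) ∷ map (y ∷_) (insertions x ys)

-- all permutations of a list (each listed once when entries are distinct)
perms : List ℕ → List (List ℕ)
perms [] = [] ∷ []
perms (x ∷ xs) = concatMap (insertions x) (perms xs)

range1 : ℕ → List ℕ
range1 n = map suc (upTo n)

-- all permutations of [n], as one-line words a₁a₂⋯aₙ
Perm : ℕ → List (List ℕ)
Perm n = perms (range1 n)

isEven : ℕ → Bool
isEven zero = true
isEven (suc n) = not (isEven n)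

ascents : List ℕ → ℕ
ascents [] = 0
ascents (x ∷ []) = 0
ascents (x ∷ y ∷ ys) = (if x <ᵇ y then 1 else 0) + ascents (y ∷ ys)

countLess : ℕ → List ℕ → ℕ
countLess x [] = 0
countLess x (y ∷ ys) = (if y <ᵇ x then 1 else 0) + countLess x ys

inversions : List ℕ → ℕ
inversions [] = 0
inversions (x ∷ xs) = countLess x xs + inversions xs

isPAP : List ℕ → Bool
isPAP [] = true
isPAP (x ∷ []) = true
isPAP (x ∷ y ∷ ys) = (isEven x xor isEven y) ∧ isPAP (y ∷ ys)

filterᵇ : {A : Set} → (A → Bool) → List A → List A
filterᵇ p [] = []
filterᵇ p (x ∷ xs) = if p x then x ∷ filterᵇ p xs else filterᵇ p xs

Xi : ℕ → ℕ → List (List ℕ)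
Xi n k = filterᵇ (λ w → isPAP w ∧ (ascents w ≡ᵇ k)) (Perm n)

P : ℕ → ℕ → ℕ
P n k = length (filterᵇ (λ w → isEven (inversions w)) (Xi n k))

Q : ℕ → ℕ → ℕ
Q n k = length (filterᵇ (λ w → not (isEven (inversions w))) (Xi n k))

R : ℕ → ℕ → ℤ
R n k = + P n k - + Q n k

{-# OPTIONS --safe #-}
module Submission where

-- Write R n k as the sum, over all permutations w of [n], of the sign of w if w is a PAP with k
-- ascents and 0 otherwise. For n = m + 1 with m odd, each permutation of [n] arises exactly once by
-- inserting n into a permutation u of [m]. Since [m] has one more odd than even entry, a PAP u of [m]
-- begins and ends with an odd entry. So putting n in front of u keeps alternation and ascents and
-- flips the sign (n passes over the m entries of u), which contributes -R(m,k); putting n at the end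
-- keeps alternation and sign and adds one ascent, which contributes R(m,k-1). The insertions A n B
-- with A and B nonempty cancel in pairs under A n B ↦ B' n A', where ' reverses a word and replaces
-- each entry i by n - i: as n is even this keeps parities, hence alternation; it keeps the ascents;
-- and it changes the number of inversions by |A| - |B|, which is odd.

open import Defs
open import Data.Bool using (Bool; true; false; _∧_; _xor_; not; if_then_else_)
open import Data.Bool.Properties
  using (∧-assoc; ∧-comm; ∧-identityʳ; ∧-zeroʳ; ∧-conicalˡ; ∧-conicalʳ;
         xor-comm; not-involutive; not-injective; not-distribˡ-xor)
open import Data.Integer as ℤ using (ℤ; +_; -_; _+_; _*_; _-_; 0ℤ; 1ℤ; -1ℤ; +[1+_]; -[1+_])
import Data.Integer.Properties as ℤ
open import Data.Integer.Solver using (module +-*-Solver)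
open import Data.List using (List; []; _∷_; _++_; _∷ʳ_; [_]; map; foldr; concatMap; length; reverse; upTo)
open import Data.List.Properties
  using (map-++; map-∘; map-cong; map-cong-local; concatMap-map; concatMap-cong; map-concatMap;
         reverse-++; unfold-reverse; reverse-involutive; reverse-map; length-reverse; length-map;
         length-upTo; length-++; upTo-∷ʳ; map-upTo; ++-assoc; ++-identityʳ; ∷-injectiveˡ; ∷-injectiveʳ)
open import Data.List.Relation.Binary.Permutation.Propositional
  using (_↭_; refl; prep; swap; trans; ↭-sym; ↭-reflexive; ↭⇒↭ₛ)
open import Data.List.Relation.Binary.Permutation.Propositional.Properties
  using (↭-reverse; ↭-length; ∷↭∷ʳ; All-resp-↭)
import Data.List.Relation.Binary.Permutation.Propositional.Properties as ↭
open import Data.List.Relation.Binary.Permutation.Setoid.Properties using (foldr-commMonoid)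
open import Data.List.Relation.Unary.All as All using (All; []; _∷_)
import Data.List.Relation.Unary.All.Properties as All
open import Data.Nat as ℕ using (ℕ; zero; suc; _≤_; _<_; _∸_; _<ᵇ_; _≡ᵇ_; z≤n; s≤s)
import Data.Nat.Properties as ℕ
open import Data.Nat.ListAction using (sum)
open import Data.Nat.ListAction.Properties using (sum-↭)
open import Data.Nat.Divisibility using (_∣_; divides)
open import Algebra.Properties.CommutativeSemigroup ℕ.+-commutativeSemigroup as ℕ+ using ()
open import Algebra.Properties.CommutativeSemigroup ℤ.+-commutativeSemigroup as ℤ+ using ()
open import Data.Empty using (⊥-elim)
open import Data.Product as × using (_×_; _,_; proj₁; proj₂; map₁; map₂)
open import Function using (_∘_)
open import Relation.Binary.PropositionalEquality
  using (_≡_; _≢_; _≗_; refl; sym; cong; cong₂; subst; setoid; module ≡-Reasoning)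
import Relation.Binary.PropositionalEquality as ≡
open import Relation.Nullary.Reflects using (of; det; fromEquivalence)

open ≡-Reasoning

private
  variable
    A B : Set
    f g : A → ℤ
    k m x y z N : ℕ
    u v w xs ys : List ℕ

-- Integer sums

i≡-i⇒i≡0 : ∀ i → i ≡ - i → i ≡ 0ℤ
i≡-i⇒i≡0 (+ zero)   _  = refl
i≡-i⇒i≡0 +[1+ _ ] ()
i≡-i⇒i≡0 -[1+ _ ] ()

∑ : (A → ℤ) → List A → ℤ
∑ f xs = foldr _+_ 0ℤ (map f xs)

∑-++ : ∀ (f : A → ℤ) xs ys → ∑ f (xs ++ ys) ≡ ∑ f xs + ∑ f ys
∑-++ f []       ys = sym (ℤ.+-identityˡ _)
∑-++ f (x ∷ xs) ys = ≡.trans (cong (λ s → f x + s) (∑-++ f xs ys)) (sym (ℤ.+-assoc (f x) _ _))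

∑-map : ∀ (f : A → ℤ) (g : B → A) (bs : List B) → ∑ f (map g bs) ≡ ∑ (f ∘ g) bs
∑-map f g bs = cong (foldr _+_ 0ℤ) (sym (map-∘ bs))

∑-concatMap : ∀ (f : A → ℤ) (g : B → List A) (bs : List B) → ∑ f (concatMap g bs) ≡ ∑ (∑ f ∘ g) bs
∑-concatMap f g []       = refl
∑-concatMap f g (b ∷ bs) = ≡.trans (∑-++ f (g b) (concatMap g bs)) (cong (λ s → ∑ f (g b) + s) (∑-concatMap f g bs))

∑-cong : f ≗ g → ∀ (xs : List A) → ∑ f xs ≡ ∑ g xs
∑-cong f≗g xs = cong (foldr _+_ 0ℤ) (map-cong f≗g xs)

∑-cong-All : {P : A → Set} {as : List A} → All P as → (∀ {a} → P a → f a ≡ g a) → ∑ f as ≡ ∑ g as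
∑-cong-All ps f≡g = cong (foldr _+_ 0ℤ) (map-cong-local (All.map f≡g ps))

∑-+ : ∀ (f g : A → ℤ) as → ∑ (λ a → f a + g a) as ≡ ∑ f as + ∑ g as
∑-+ f g []       = refl
∑-+ f g (a ∷ as) = ≡.trans (cong (λ s → (f a + g a) + s) (∑-+ f g as)) (ℤ+.interchange (f a) (g a) (∑ f as) (∑ g as))

∑-neg : ∀ (f : A → ℤ) as → ∑ (λ a → - f a) as ≡ - ∑ f as
∑-neg f []       = refl
∑-neg f (a ∷ as) = ≡.trans (cong (λ s → - f a + s) (∑-neg f as)) (sym (ℤ.neg-distrib-+ (f a) (∑ f as)))

∑-↭ : ∀ (f : A → ℤ) {as bs} → as ↭ bs → ∑ f as ≡ ∑ f bs
∑-↭ f p = foldr-commMonoid (setoid ℤ) ℤ.+-0-isCommutativeMonoid (↭⇒↭ₛ (↭.map⁺ f p))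

∑-filterᵇ : ∀ (f : A → ℤ) p as → ∑ f (filterᵇ p as) ≡ ∑ (λ a → if p a then f a else 0ℤ) as
∑-filterᵇ f p []       = refl
∑-filterᵇ f p (a ∷ as) with p a
... | true  = cong (λ s → f a + s) (∑-filterᵇ f p as)
... | false = ≡.trans (∑-filterᵇ f p as) (sym (ℤ.+-identityˡ _))

signed-length-filterᵇ : ∀ (p : A → Bool) as →
  + length (filterᵇ p as) - + length (filterᵇ (λ a → not (p a)) as) ≡ ∑ (λ a → if p a then 1ℤ else -1ℤ) as
signed-length-filterᵇ p []       = refl
signed-length-filterᵇ p (a ∷ as) with p a
... | true  = ≡.trans (solve 2 (λ i j → (con 1ℤ :+ i) :- j := con 1ℤ :+ (i :- j)) refl
                               (+ length (filterᵇ p as)) (+ length (filterᵇ (λ a → not (p a)) as)))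
                      (cong (λ s → 1ℤ + s) (signed-length-filterᵇ p as))
  where open +-*-Solver
... | false = ≡.trans (solve 2 (λ i j → i :- (con 1ℤ :+ j) := con -1ℤ :+ (i :- j)) refl
                               (+ length (filterᵇ p as)) (+ length (filterᵇ (λ a → not (p a)) as)))
                      (cong (λ s → -1ℤ + s) (signed-length-filterᵇ p as))
  where open +-*-Solver

-- Signs and weights

isEven-+ : ∀ i j → isEven (i ℕ.+ j) ≡ not (isEven i xor isEven j)
isEven-+ zero    j = sym (not-involutive _)
isEven-+ (suc i) j = cong not (≡.trans (isEven-+ i j) (not-distribˡ-xor (isEven i) (isEven j)))

isEven-*2 : ∀ q → isEven (q ℕ.* 2) ≡ true
isEven-*2 zero    = refl
isEven-*2 (suc q) = ≡.trans (not-involutive _) (isEven-*2 q)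

2∣suc⇒odd : 2 ∣ suc m → isEven m ≡ false
2∣suc⇒odd (divides q eq) = not-injective (≡.trans (cong isEven eq) (isEven-*2 q))

isEven-∸ : isEven N ≡ true → z ≤ N → isEven (N ∸ z) ≡ isEven z
isEven-∸ {N} {z} even z≤N = same-parity (isEven (N ∸ z)) (isEven z)
  (≡.trans (sym (isEven-+ (N ∸ z) z)) (≡.trans (cong isEven (ℕ.m∸n+n≡m z≤N)) even))
  where
  same-parity : ∀ a b → not (a xor b) ≡ true → a ≡ b
  same-parity true  true  _ = refl
  same-parity false false _ = refl
  same-parity true  false ()
  same-parity false true  ()

sgn : ℕ → ℤ
sgn i = if isEven i then 1ℤ else -1ℤ

sgn-+ : ∀ i j → sgn (i ℕ.+ j) ≡ sgn i * sgn j
sgn-+ i j = ≡.trans (cong (λ b → if b then 1ℤ else -1ℤ) (isEven-+ i j)) (multiplicative (isEven i) (isEven j))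
  where
  multiplicative : ∀ a b → (if not (a xor b) then 1ℤ else -1ℤ) ≡ (if a then 1ℤ else -1ℤ) * (if b then 1ℤ else -1ℤ)
  multiplicative true  true  = refl
  multiplicative true  false = refl
  multiplicative false true  = refl
  multiplicative false false = refl

sgn-odd : isEven m ≡ false → sgn m ≡ -1ℤ
sgn-odd odd = cong (λ b → if b then 1ℤ else -1ℤ) odd

sgn-odd-+ : ∀ i j → isEven (i ℕ.+ j) ≡ false → sgn i ≡ - sgn j
sgn-odd-+ i j odd = opposite (isEven i) (isEven j) (≡.trans (sym (isEven-+ i j)) odd)
  where
  opposite : ∀ a b → not (a xor b) ≡ false → (if a then 1ℤ else -1ℤ) ≡ - (if b then 1ℤ else -1ℤ)
  opposite true  false _ = refl
  opposite false true  _ = refl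
  opposite true  true  ()
  opposite false false ()

sign : List ℕ → ℤ
sign w = sgn (inversions w)

weight : ℕ → List ℕ → ℤ
weight k w = if isPAP w ∧ (ascents w ≡ᵇ k) then sign w else 0ℤ

R≡∑weight : ∀ n k → R n k ≡ ∑ (weight k) (Perm n)
R≡∑weight n k = ≡.trans (signed-length-filterᵇ (isEven ∘ inversions) (Xi n k))
                        (∑-filterᵇ sign (λ w → isPAP w ∧ (ascents w ≡ᵇ k)) (Perm n))

weight-neg : ∀ v w → isPAP v ≡ isPAP w → ascents v ≡ ascents w → sign v ≡ - sign w →
  weight k v ≡ - weight k w
weight-neg {k} v w pap asc sg = begin
  weight k v
    ≡⟨ cong₂ (λ c s → if c then s else 0ℤ) (cong₂ (λ p a → p ∧ (a ≡ᵇ k)) pap asc) sg ⟩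
  (if isPAP w ∧ (ascents w ≡ᵇ k) then - sign w else 0ℤ)
    ≡⟨ neg-if (isPAP w ∧ (ascents w ≡ᵇ k)) ⟩
  - weight k w ∎
  where
  neg-if : ∀ c → (if c then - sign w else 0ℤ) ≡ - (if c then sign w else 0ℤ)
  neg-if true  = refl
  neg-if false = refl

weight-suc : ∀ v w → isPAP v ≡ isPAP w → ascents v ≡ suc (ascents w) → sign v ≡ sign w →
  weight (suc k) v ≡ weight k w
weight-suc {k} v w pap asc sg =
  cong₂ (λ c s → if c then s else 0ℤ) (cong₂ (λ p a → p ∧ (a ≡ᵇ suc k)) pap asc) sg

-- Ascents, alternation and inversions

<⇒<ᵇ≡true : x < y → (x <ᵇ y) ≡ true
<⇒<ᵇ≡true {x} {y} x<y = det (ℕ.<ᵇ-reflects-< x y) (of x<y)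

≥⇒<ᵇ≡false : y ≤ x → (x <ᵇ y) ≡ false
≥⇒<ᵇ≡false {y} {x} y≤x = det (ℕ.<ᵇ-reflects-< x y) (of (ℕ.≤⇒≯ y≤x))

complement-<ᵇ : y ≤ N → (N ∸ y <ᵇ N ∸ x) ≡ (x <ᵇ y)
complement-<ᵇ {y} {N} {x} y≤N = det (ℕ.<ᵇ-reflects-< (N ∸ y) (N ∸ x)) (fromEquivalence
  (λ x<ᵇy → ℕ.∸-monoʳ-< (ℕ.<ᵇ⇒< x y x<ᵇy) y≤N)
  (λ lt → ℕ.<⇒<ᵇ {x} {y} (ℕ.≰⇒> (λ y≤x → ℕ.<⇒≱ lt (ℕ.∸-monoʳ-≤ N y≤x)))))

reverse-++-∷ : ∀ (xs : List A) y ys → reverse (xs ++ y ∷ ys) ≡ reverse ys ++ y ∷ reverse xs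
reverse-++-∷ xs y ys = begin
  reverse (xs ++ y ∷ ys)          ≡⟨ reverse-++ xs (y ∷ ys) ⟩
  reverse (y ∷ ys) ++ reverse xs  ≡⟨ cong (_++ reverse xs) (unfold-reverse y ys) ⟩
  (reverse ys ∷ʳ y) ++ reverse xs ≡⟨ ++-assoc (reverse ys) [ y ] (reverse xs) ⟩
  reverse ys ++ y ∷ reverse xs    ∎

ascents-++-∷ : ∀ xs y ys → ascents (xs ++ y ∷ ys) ≡ ascents (xs ∷ʳ y) ℕ.+ ascents (y ∷ ys)
ascents-++-∷ []            y ys = refl
ascents-++-∷ (x ∷ [])      y ys = cong (λ a → a ℕ.+ ascents (y ∷ ys)) (sym (ℕ.+-identityʳ _))
ascents-++-∷ (x ∷ x′ ∷ xs) y ys =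
  ≡.trans (cong ((if x <ᵇ x′ then 1 else 0) ℕ.+_) (ascents-++-∷ (x′ ∷ xs) y ys))
          (sym (ℕ.+-assoc (if x <ᵇ x′ then 1 else 0) (ascents (x′ ∷ xs ∷ʳ y)) (ascents (y ∷ ys))))

isPAP-++-∷ : ∀ xs y ys → isPAP (xs ++ y ∷ ys) ≡ isPAP (xs ∷ʳ y) ∧ isPAP (y ∷ ys)
isPAP-++-∷ []            y ys = refl
isPAP-++-∷ (x ∷ [])      y ys = cong (_∧ isPAP (y ∷ ys)) (sym (∧-identityʳ _))
isPAP-++-∷ (x ∷ x′ ∷ xs) y ys =
  ≡.trans (cong ((isEven x xor isEven x′) ∧_) (isPAP-++-∷ (x′ ∷ xs) y ys))
          (sym (∧-assoc (isEven x xor isEven x′) (isPAP (x′ ∷ xs ∷ʳ y)) (isPAP (y ∷ ys))))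

descents : List ℕ → ℕ
descents []           = 0
descents (x ∷ [])     = 0
descents (x ∷ y ∷ ys) = (if y <ᵇ x then 1 else 0) ℕ.+ descents (y ∷ ys)

ascents-reverse : ∀ w → ascents (reverse w) ≡ descents w
ascents-reverse []          = refl
ascents-reverse (x ∷ [])    = refl
ascents-reverse (x ∷ y ∷ w) = begin
  ascents (reverse (x ∷ y ∷ w))                   ≡⟨ cong ascents (reverse-++-∷ [ x ] y w) ⟩
  ascents (reverse w ++ y ∷ [ x ])                ≡⟨ ascents-++-∷ (reverse w) y [ x ] ⟩
  ascents (reverse w ∷ʳ y) ℕ.+ ascents (y ∷ [ x ])
    ≡⟨ cong₂ ℕ._+_ (cong ascents (unfold-reverse y w)) (sym (ℕ.+-identityʳ _)) ⟨
  ascents (reverse (y ∷ w)) ℕ.+ (if y <ᵇ x then 1 else 0)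
    ≡⟨ cong (ℕ._+ _) (ascents-reverse (y ∷ w)) ⟩
  descents (y ∷ w) ℕ.+ (if y <ᵇ x then 1 else 0)
    ≡⟨ ℕ.+-comm (descents (y ∷ w)) _ ⟩
  descents (x ∷ y ∷ w) ∎

isPAP-reverse : ∀ w → isPAP (reverse w) ≡ isPAP w
isPAP-reverse []          = refl
isPAP-reverse (x ∷ [])    = refl
isPAP-reverse (x ∷ y ∷ w) = begin
  isPAP (reverse (x ∷ y ∷ w))                ≡⟨ cong isPAP (reverse-++-∷ [ x ] y w) ⟩
  isPAP (reverse w ++ y ∷ [ x ])             ≡⟨ isPAP-++-∷ (reverse w) y [ x ] ⟩
  isPAP (reverse w ∷ʳ y) ∧ isPAP (y ∷ [ x ])
    ≡⟨ cong₂ _∧_ (cong isPAP (unfold-reverse y w)) (sym (∧-identityʳ _)) ⟨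
  isPAP (reverse (y ∷ w)) ∧ (isEven y xor isEven x)
    ≡⟨ cong (_∧ _) (isPAP-reverse (y ∷ w)) ⟩
  isPAP (y ∷ w) ∧ (isEven y xor isEven x)
    ≡⟨ ∧-comm (isPAP (y ∷ w)) _ ⟩
  (isEven y xor isEven x) ∧ isPAP (y ∷ w)
    ≡⟨ cong (_∧ isPAP (y ∷ w)) (xor-comm (isEven y) (isEven x)) ⟩
  isPAP (x ∷ y ∷ w) ∎

isPAP-parity : map isEven v ≡ map isEven w → isPAP v ≡ isPAP w
isPAP-parity {[]}         {[]}         _  = refl
isPAP-parity {x ∷ []}     {y ∷ []}     _  = refl
isPAP-parity {x ∷ x′ ∷ v} {y ∷ y′ ∷ w} eq = cong₂ _∧_
  (cong₂ _xor_ (∷-injectiveˡ eq) (∷-injectiveˡ (∷-injectiveʳ eq))) (isPAP-parity (∷-injectiveʳ eq))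

reverseComplement : ℕ → List ℕ → List ℕ
reverseComplement N w = reverse (map (N ∸_) w)

reverseComplement-++ : ∀ N xs ys →
  reverseComplement N (xs ++ ys) ≡ reverseComplement N ys ++ reverseComplement N xs
reverseComplement-++ N xs ys =
  ≡.trans (cong reverse (map-++ (N ∸_) xs ys)) (reverse-++ (map (N ∸_) xs) (map (N ∸_) ys))

reverseComplement-≢[] : ∀ N xs → xs ≢ [] → reverseComplement N xs ≢ []
reverseComplement-≢[] N []       xs≢[] _  = xs≢[] refl
reverseComplement-≢[] N (x ∷ xs) _     eq =
  ℕ.1+n≢0 (≡.trans (sym (length-reverse (map (N ∸_) (x ∷ xs)))) (cong length eq))

descents-complement : All (_≤ N) w → descents (map (N ∸_) w) ≡ ascents w
descents-complement []                    = refl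
descents-complement (_ ∷ [])              = refl
descents-complement (_ ∷ y≤N ∷ w≤N) =
  cong₂ ℕ._+_ (cong (λ b → if b then 1 else 0) (complement-<ᵇ y≤N)) (descents-complement (y≤N ∷ w≤N))

ascents-reverseComplement : All (_≤ N) w → ascents (reverseComplement N w) ≡ ascents w
ascents-reverseComplement {N} {w} w≤N = ≡.trans (ascents-reverse (map (N ∸_) w)) (descents-complement w≤N)

map-isEven-complement : isEven N ≡ true → All (_≤ N) w → map isEven (map (N ∸_) w) ≡ map isEven w
map-isEven-complement {w = w} even w≤N =
  ≡.trans (sym (map-∘ w)) (map-cong-local (All.map (isEven-∸ even) w≤N))

All-reverse : {P : A → Set} {as : List A} → All P as → All P (reverse as)
All-reverse {as = as} = All-resp-↭ (↭-sym (↭-reverse as))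

countGreater : ℕ → List ℕ → ℕ
countGreater y xs = sum (map (λ x → if y <ᵇ x then 1 else 0) xs)

countLess-∷ʳ : ∀ x xs y → countLess x (xs ∷ʳ y) ≡ countLess x xs ℕ.+ (if y <ᵇ x then 1 else 0)
countLess-∷ʳ x []       y = ℕ.+-identityʳ _
countLess-∷ʳ x (z ∷ xs) y = ≡.trans (cong ((if z <ᵇ x then 1 else 0) ℕ.+_) (countLess-∷ʳ x xs y))
  (sym (ℕ.+-assoc (if z <ᵇ x then 1 else 0) (countLess x xs) _))

inversions-∷ʳ : ∀ xs y → inversions (xs ∷ʳ y) ≡ inversions xs ℕ.+ countGreater y xs
inversions-∷ʳ []       y = refl
inversions-∷ʳ (x ∷ xs) y =
  ≡.trans (cong₂ ℕ._+_ (countLess-∷ʳ x xs y) (inversions-∷ʳ xs y))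
          (ℕ+.interchange (countLess x xs) (if y <ᵇ x then 1 else 0) (inversions xs) (countGreater y xs))

countGreater-complement : z ≤ N → All (_≤ N) w → countGreater (N ∸ z) (map (N ∸_) w) ≡ countLess z w
countGreater-complement z≤N []            = refl
countGreater-complement z≤N (_ ∷ w≤N) =
  cong₂ ℕ._+_ (cong (λ b → if b then 1 else 0) (complement-<ᵇ z≤N)) (countGreater-complement z≤N w≤N)

inversions-reverseComplement : All (_≤ N) w → inversions (reverseComplement N w) ≡ inversions w
inversions-reverseComplement             []              = refl
inversions-reverseComplement {N} {z ∷ w} (z≤N ∷ w≤N) = begin
  inversions (reverse (N ∸ z ∷ map (N ∸_) w))        ≡⟨ cong inversions (unfold-reverse (N ∸ z) (map (N ∸_) w)) ⟩
  inversions (reverseComplement N w ∷ʳ (N ∸ z))      ≡⟨ inversions-∷ʳ (reverseComplement N w) (N ∸ z) ⟩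
  inversions (reverseComplement N w) ℕ.+ countGreater (N ∸ z) (reverseComplement N w)
    ≡⟨ cong₂ ℕ._+_ (inversions-reverseComplement w≤N) (sum-↭ (↭.map⁺ _ (↭-reverse (map (N ∸_) w)))) ⟩
  inversions w ℕ.+ countGreater (N ∸ z) (map (N ∸_) w)
    ≡⟨ cong (inversions w ℕ.+_) (countGreater-complement z≤N w≤N) ⟩
  inversions w ℕ.+ countLess z w                     ≡⟨ ℕ.+-comm (inversions w) _ ⟩
  inversions (z ∷ w)                                 ∎

countLess-max : All (_< N) ys → countLess N ys ≡ length ys
countLess-max []            = refl
countLess-max (y<N ∷ ys<N) rewrite <⇒<ᵇ≡true y<N = cong suc (countLess-max ys<N)

countLess-insert-max : ∀ xs → x ≤ N → countLess x (xs ++ N ∷ ys) ≡ countLess x (xs ++ ys)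
countLess-insert-max []       x≤N rewrite ≥⇒<ᵇ≡false x≤N = refl
countLess-insert-max {x} (y ∷ xs) x≤N = cong ((if y <ᵇ x then 1 else 0) ℕ.+_) (countLess-insert-max xs x≤N)

inversions-insert-max : All (_≤ N) xs → All (_< N) ys →
  inversions (xs ++ N ∷ ys) ≡ length ys ℕ.+ inversions (xs ++ ys)
inversions-insert-max             []            ys<N = cong (ℕ._+ _) (countLess-max ys<N)
inversions-insert-max {xs = x ∷ xs} {ys} (x≤N ∷ xs≤N) ys<N = begin
  countLess x (xs ++ _ ∷ ys) ℕ.+ inversions (xs ++ _ ∷ ys)
    ≡⟨ cong₂ ℕ._+_ (countLess-insert-max xs x≤N) (inversions-insert-max xs≤N ys<N) ⟩
  countLess x (xs ++ ys) ℕ.+ (length ys ℕ.+ inversions (xs ++ ys))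
    ≡⟨ ℕ+.x∙yz≈y∙xz (countLess x (xs ++ ys)) (length ys) _ ⟩
  length ys ℕ.+ inversions (x ∷ xs ++ ys) ∎

sign-insert-max : All (_≤ N) xs → All (_< N) ys → sign (xs ++ N ∷ ys) ≡ sgn (length ys) * sign (xs ++ ys)
sign-insert-max {ys = ys} xs≤N ys<N =
  ≡.trans (cong sgn (inversions-insert-max xs≤N ys<N)) (sgn-+ (length ys) _)

ascents-max-∷ : All (_≤ N) ys → ascents (N ∷ ys) ≡ ascents ys
ascents-max-∷ []          = refl
ascents-max-∷ (y≤N ∷ _) rewrite ≥⇒<ᵇ≡false y≤N = refl

ascents-∷ʳ-max : All (_< N) xs → xs ≢ [] → ascents (xs ∷ʳ N) ≡ suc (ascents xs)
ascents-∷ʳ-max []                      xs≢[] = ⊥-elim (xs≢[] refl)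
ascents-∷ʳ-max (x<N ∷ [])              _ rewrite <⇒<ᵇ≡true x<N = refl
ascents-∷ʳ-max {xs = x ∷ x′ ∷ xs} (_ ∷ xs<N) _ =
  ≡.trans (cong ((if x <ᵇ x′ then 1 else 0) ℕ.+_) (ascents-∷ʳ-max xs<N λ ())) (ℕ.+-suc _ _)

ascents-insert-max : All (_< N) xs → xs ≢ [] → All (_≤ N) ys →
  ascents (xs ++ N ∷ ys) ≡ suc (ascents xs ℕ.+ ascents ys)
ascents-insert-max {N} {xs} {ys} xs<N xs≢[] ys≤N =
  ≡.trans (ascents-++-∷ xs N ys) (cong₂ ℕ._+_ (ascents-∷ʳ-max xs<N xs≢[]) (ascents-max-∷ ys≤N))

isPAP-even-∷ : isEven y ≡ true → (isPAP (x ∷ v) ≡ true → isEven x ≡ false) →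
  isPAP (y ∷ x ∷ v) ≡ isPAP (x ∷ v)
isPAP-even-∷ {y} {x} {v} y-even head-odd with isPAP (x ∷ v)
... | false = ∧-zeroʳ _
... | true rewrite y-even | head-odd refl = refl

-- Permutations of [m] for odd m

range1-suc : ∀ m → range1 (suc m) ≡ range1 m ∷ʳ suc m
range1-suc m = ≡.trans (cong (map suc) (sym (upTo-∷ʳ m))) (map-++ suc (upTo m) [ m ])

range1-∷ : ∀ m → range1 (suc m) ≡ 1 ∷ map suc (range1 m)
range1-∷ m = cong (λ l → 1 ∷ map suc l) (sym (map-upTo suc m))

length-range1 : ∀ m → length (range1 m) ≡ m
length-range1 m = ≡.trans (length-map suc (upTo m)) (length-upTo m)

complement-range1 : ∀ m → map (suc m ∸_) (range1 m) ≡ reverse (range1 m)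
complement-range1 zero    = refl
complement-range1 (suc m) = begin
  map (suc (suc m) ∸_) (range1 (suc m))   ≡⟨ cong (map (suc (suc m) ∸_)) (range1-∷ m) ⟩
  suc m ∷ map (suc (suc m) ∸_) (map suc (range1 m)) ≡⟨ cong (suc m ∷_) (sym (map-∘ (range1 m))) ⟩
  suc m ∷ map (suc m ∸_) (range1 m)       ≡⟨ cong (suc m ∷_) (complement-range1 m) ⟩
  suc m ∷ reverse (range1 m)              ≡⟨ reverse-++ (range1 m) [ suc m ] ⟨
  reverse (range1 m ∷ʳ suc m)             ≡⟨ cong reverse (range1-suc m) ⟨
  reverse (range1 (suc m))                ∎

InRange : ℕ → ℕ → Set
InRange N z = 0 < z × z < N

complement-InRange : InRange N z → InRange N (N ∸ z)
complement-InRange (0<z , z<N) = ℕ.m<n⇒0<n∸m z<N , ℕ.∸-monoʳ-< 0<z (ℕ.<⇒≤ z<N)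

reverseComplement-InRange : All (InRange N) w → All (InRange N) (reverseComplement N w)
reverseComplement-InRange w-in = All-reverse (All.map⁺ (All.map complement-InRange w-in))

All-InRange⇒< : All (InRange N) w → All (_< N) w
All-InRange⇒< = All.map proj₂

All-InRange⇒≤ : All (InRange N) w → All (_≤ N) w
All-InRange⇒≤ = All.map (ℕ.<⇒≤ ∘ proj₂)

↭-range1⇒InRange : u ↭ range1 m → All (InRange (suc m)) u
↭-range1⇒InRange {m = m} p =
  All-resp-↭ (↭-sym p) (All.map⁺ (All.map (λ i<m → s≤s z≤n , s≤s i<m) (All.all-upTo m)))

oddness : ℕ → ℤ
oddness i = if isEven i then -1ℤ else 1ℤ

oddExcess : List ℕ → ℤ
oddExcess = ∑ oddness

oddExcess-range1 : ∀ m → oddExcess (range1 m) ≡ (if isEven m then 0ℤ else 1ℤ)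
oddExcess-range1 zero    = refl
oddExcess-range1 (suc m) = begin
  oddExcess (range1 (suc m))                          ≡⟨ cong oddExcess (range1-suc m) ⟩
  oddExcess (range1 m ∷ʳ suc m)                       ≡⟨ ∑-++ oddness (range1 m) [ suc m ] ⟩
  oddExcess (range1 m) + oddExcess [ suc m ]          ≡⟨ cong (_+ oddExcess [ suc m ]) (oddExcess-range1 m) ⟩
  (if isEven m then 0ℤ else 1ℤ) + oddExcess [ suc m ] ≡⟨ step (isEven m) ⟩
  (if isEven (suc m) then 0ℤ else 1ℤ)                 ∎
  where
  step : ∀ b → (if b then 0ℤ else 1ℤ) + ((if not b then -1ℤ else 1ℤ) + 0ℤ) ≡ (if not b then 0ℤ else 1ℤ)
  step true  = refl
  step false = refl

oddExcess-PAP : ∀ x v → isPAP (x ∷ v) ≡ true → isEven (length v) ≡ true → oddExcess (x ∷ v) ≡ oddness x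
oddExcess-PAP x []          _   _    = ℤ.+-identityʳ (oddness x)
oddExcess-PAP x (_ ∷ [])    _   ()
oddExcess-PAP x (y ∷ z ∷ v) pap even = begin
  oddness x + (oddness y + oddExcess (z ∷ v))
    ≡⟨ cong (λ s → oddness x + (oddness y + s)) (oddExcess-PAP z v zv-PAP v-even) ⟩
  oddness x + (oddness y + oddness z)
    ≡⟨ cong (λ s → oddness x + s) (cancel (isEven y) (isEven z) yz-alternate) ⟩
  oddness x + 0ℤ
    ≡⟨ ℤ.+-identityʳ (oddness x) ⟩
  oddness x ∎
  where
  yzv-PAP : isPAP (y ∷ z ∷ v) ≡ true
  yzv-PAP = ∧-conicalʳ (isEven x xor isEven y) (isPAP (y ∷ z ∷ v)) pap
  zv-PAP : isPAP (z ∷ v) ≡ true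
  zv-PAP = ∧-conicalʳ (isEven y xor isEven z) (isPAP (z ∷ v)) yzv-PAP
  yz-alternate : isEven y xor isEven z ≡ true
  yz-alternate = ∧-conicalˡ (isEven y xor isEven z) (isPAP (z ∷ v)) yzv-PAP
  v-even : isEven (length v) ≡ true
  v-even = ≡.trans (sym (not-involutive _)) even
  cancel : ∀ a b → a xor b ≡ true → (if a then -1ℤ else 1ℤ) + (if b then -1ℤ else 1ℤ) ≡ 0ℤ
  cancel true  false _ = refl
  cancel false true  _ = refl
  cancel true  true  ()
  cancel false false ()

↭-range1-length : u ↭ range1 m → length u ≡ m
↭-range1-length {m = m} p = ≡.trans (↭-length p) (length-range1 m)

↭-range1-≢[] : isEven m ≡ false → u ↭ range1 m → u ≢ []
↭-range1-≢[] m-odd p refl with ≡.trans (cong isEven (↭-range1-length p)) m-odd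
... | ()

PAP⇒head-odd : isEven m ≡ false → x ∷ v ↭ range1 m → isPAP (x ∷ v) ≡ true → isEven x ≡ false
PAP⇒head-odd {m} {x} {v} m-odd p pap = oddness≡1 (isEven x) (begin
  oddness x                     ≡⟨ oddExcess-PAP x v pap v-even ⟨
  oddExcess (x ∷ v)             ≡⟨ ∑-↭ oddness p ⟩
  oddExcess (range1 m)          ≡⟨ oddExcess-range1 m ⟩
  (if isEven m then 0ℤ else 1ℤ) ≡⟨ cong (λ b → if b then 0ℤ else 1ℤ) m-odd ⟩
  1ℤ                            ∎)
  where
  v-even : isEven (length v) ≡ true
  v-even = not-injective (≡.trans (cong isEven (↭-range1-length p)) m-odd)
  oddness≡1 : ∀ b → (if b then -1ℤ else 1ℤ) ≡ 1ℤ → b ≡ false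
  oddness≡1 false _  = refl
  oddness≡1 true  ()

isPAP-max-∷ : isEven m ≡ false → u ↭ range1 m → isPAP (suc m ∷ u) ≡ isPAP u
isPAP-max-∷ {m} {[]}    m-odd p = refl
isPAP-max-∷ {m} {x ∷ v} m-odd p = isPAP-even-∷ {suc m} {x} {v} (cong not m-odd) (PAP⇒head-odd m-odd p)

weight-max-∷ : isEven m ≡ false → u ↭ range1 m → weight k (suc m ∷ u) ≡ - weight k u
weight-max-∷ {m} {u} m-odd p =
  weight-neg (suc m ∷ u) u (isPAP-max-∷ m-odd p) (ascents-max-∷ (All-InRange⇒≤ u-in)) (begin
    sign (suc m ∷ u)        ≡⟨ sign-insert-max [] (All-InRange⇒< u-in) ⟩
    sgn (length u) * sign u ≡⟨ cong (λ i → sgn i * sign u) (↭-range1-length p) ⟩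
    sgn m * sign u          ≡⟨ cong (_* sign u) (sgn-odd {m} m-odd) ⟩
    -1ℤ * sign u            ≡⟨ ℤ.-1*i≡-i (sign u) ⟩
    - sign u                ∎)
  where
  u-in : All (InRange (suc m)) u
  u-in = ↭-range1⇒InRange p

weight-∷ʳ-max : isEven m ≡ false → u ↭ range1 m → weight (suc k) (u ∷ʳ suc m) ≡ weight k u
weight-∷ʳ-max {m} {u} m-odd p = weight-suc (u ∷ʳ suc m) u pap asc sg
  where
  u-in : All (InRange (suc m)) u
  u-in = ↭-range1⇒InRange p
  pap : isPAP (u ∷ʳ suc m) ≡ isPAP u
  pap = begin
    isPAP (u ∷ʳ suc m)           ≡⟨ isPAP-reverse (u ∷ʳ suc m) ⟨
    isPAP (reverse (u ∷ʳ suc m)) ≡⟨ cong isPAP (reverse-++ u [ suc m ]) ⟩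
    isPAP (suc m ∷ reverse u)    ≡⟨ isPAP-max-∷ m-odd (trans (↭-reverse u) p) ⟩
    isPAP (reverse u)            ≡⟨ isPAP-reverse u ⟩
    isPAP u                      ∎
  asc : ascents (u ∷ʳ suc m) ≡ suc (ascents u)
  asc = ≡.trans (ascents-insert-max (All-InRange⇒< u-in) (↭-range1-≢[] m-odd p) [])
                (cong suc (ℕ.+-identityʳ (ascents u)))
  sg : sign (u ∷ʳ suc m) ≡ sign u
  sg = ≡.trans (sign-insert-max (All-InRange⇒≤ u-in) [])
               (≡.trans (ℤ.*-identityˡ (sign (u ++ []))) (cong sign (++-identityʳ u)))

isPAP-flip : isEven N ≡ true → All (_≤ N) xs → All (_≤ N) ys →
  isPAP (reverseComplement N ys ++ N ∷ reverseComplement N xs) ≡ isPAP (xs ++ N ∷ ys)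
isPAP-flip {N} {xs} {ys} N-even xs≤N ys≤N = begin
  isPAP (rc ys ++ N ∷ rc xs)
    ≡⟨ isPAP-reverse (rc ys ++ N ∷ rc xs) ⟨
  isPAP (reverse (rc ys ++ N ∷ rc xs))
    ≡⟨ cong isPAP (reverse-++-∷ (rc ys) N (rc xs)) ⟩
  isPAP (reverse (rc xs) ++ N ∷ reverse (rc ys))
    ≡⟨ cong₂ (λ as bs → isPAP (as ++ N ∷ bs)) (reverse-involutive (map (N ∸_) xs))
                                              (reverse-involutive (map (N ∸_) ys)) ⟩
  isPAP (map (N ∸_) xs ++ N ∷ map (N ∸_) ys)
    ≡⟨ isPAP-parity parity-word ⟩
  isPAP (xs ++ N ∷ ys) ∎
  where
  rc : List ℕ → List ℕ
  rc = reverseComplement N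
  parity-word : map isEven (map (N ∸_) xs ++ N ∷ map (N ∸_) ys) ≡ map isEven (xs ++ N ∷ ys)
  parity-word = begin
    map isEven (map (N ∸_) xs ++ N ∷ map (N ∸_) ys)
      ≡⟨ map-++ isEven (map (N ∸_) xs) _ ⟩
    map isEven (map (N ∸_) xs) ++ isEven N ∷ map isEven (map (N ∸_) ys)
      ≡⟨ cong₂ (λ as bs → as ++ isEven N ∷ bs) (map-isEven-complement N-even xs≤N)
                                               (map-isEven-complement N-even ys≤N) ⟩
    map isEven xs ++ isEven N ∷ map isEven ys
      ≡⟨ map-++ isEven xs (N ∷ ys) ⟨
    map isEven (xs ++ N ∷ ys) ∎

ascents-flip : All (InRange N) xs → All (InRange N) ys → xs ≢ [] → ys ≢ [] →
  ascents (reverseComplement N ys ++ N ∷ reverseComplement N xs) ≡ ascents (xs ++ N ∷ ys)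
ascents-flip {N} {xs} {ys} xs-in ys-in xs≢[] ys≢[] = begin
  ascents (rc ys ++ N ∷ rc xs)
    ≡⟨ ascents-insert-max (All-InRange⇒< (reverseComplement-InRange ys-in)) (reverseComplement-≢[] N ys ys≢[])
                          (All-InRange⇒≤ (reverseComplement-InRange xs-in)) ⟩
  suc (ascents (rc ys) ℕ.+ ascents (rc xs))
    ≡⟨ cong suc (cong₂ ℕ._+_ (ascents-reverseComplement (All-InRange⇒≤ ys-in))
                             (ascents-reverseComplement (All-InRange⇒≤ xs-in))) ⟩
  suc (ascents ys ℕ.+ ascents xs)
    ≡⟨ cong suc (ℕ.+-comm (ascents ys) (ascents xs)) ⟩
  suc (ascents xs ℕ.+ ascents ys)
    ≡⟨ ascents-insert-max (All-InRange⇒< xs-in) xs≢[] (All-InRange⇒≤ ys-in) ⟨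
  ascents (xs ++ N ∷ ys) ∎
  where
  rc : List ℕ → List ℕ
  rc = reverseComplement N

sign-flip : All (InRange N) xs → All (InRange N) ys → isEven (length xs ℕ.+ length ys) ≡ false →
  sign (reverseComplement N ys ++ N ∷ reverseComplement N xs) ≡ - sign (xs ++ N ∷ ys)
sign-flip {N} {xs} {ys} xs-in ys-in odd = begin
  sign (rc ys ++ N ∷ rc xs)
    ≡⟨ sign-insert-max (All-InRange⇒≤ (reverseComplement-InRange ys-in))
                       (All-InRange⇒< (reverseComplement-InRange xs-in)) ⟩
  sgn (length (rc xs)) * sign (rc ys ++ rc xs)
    ≡⟨ cong₂ (λ i w → sgn i * sign w) length-rc (sym (reverseComplement-++ N xs ys)) ⟩
  sgn (length xs) * sign (rc (xs ++ ys))
    ≡⟨ cong₂ _*_ (sgn-odd-+ (length xs) (length ys) odd)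
                 (cong sgn (inversions-reverseComplement (All.++⁺ (All-InRange⇒≤ xs-in) (All-InRange⇒≤ ys-in)))) ⟩
  - sgn (length ys) * sign (xs ++ ys)
    ≡⟨ ℤ.neg-distribˡ-* (sgn (length ys)) (sign (xs ++ ys)) ⟨
  - (sgn (length ys) * sign (xs ++ ys))
    ≡⟨ cong -_ (sign-insert-max (All-InRange⇒≤ xs-in) (All-InRange⇒< ys-in)) ⟨
  - sign (xs ++ N ∷ ys) ∎
  where
  rc : List ℕ → List ℕ
  rc = reverseComplement N
  length-rc : length (rc xs) ≡ length xs
  length-rc = ≡.trans (length-reverse (map (N ∸_) xs)) (length-map (N ∸_) xs)

weight-flip : isEven m ≡ false → xs ++ ys ↭ range1 m → xs ≢ [] → ys ≢ [] →
  weight k (reverseComplement (suc m) ys ++ suc m ∷ reverseComplement (suc m) xs) ≡ - weight k (xs ++ suc m ∷ ys)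
weight-flip {m} {xs} {ys} m-odd p xs≢[] ys≢[] =
  weight-neg (reverseComplement (suc m) ys ++ suc m ∷ reverseComplement (suc m) xs) (xs ++ suc m ∷ ys)
    (isPAP-flip (cong not m-odd) (All-InRange⇒≤ xs-in) (All-InRange⇒≤ ys-in))
    (ascents-flip xs-in ys-in xs≢[] ys≢[])
    (sign-flip xs-in ys-in (≡.trans (cong isEven (≡.trans (sym (length-++ xs)) (↭-range1-length p))) m-odd))
  where
  xs-in : All (InRange (suc m)) xs
  xs-in = All.++⁻ˡ xs (↭-range1⇒InRange p)
  ys-in : All (InRange (suc m)) ys
  ys-in = All.++⁻ʳ xs (↭-range1⇒InRange p)

-- Splittings of a word

splits : List A → List (List A × List A)
splits []       = ([] , []) ∷ []
splits (x ∷ xs) = ([] , x ∷ xs) ∷ map (map₁ (x ∷_)) (splits xs)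

splits-++ : ∀ (as : List A) → All (λ (bs , cs) → bs ++ cs ≡ as) (splits as)
splits-++ []       = refl ∷ []
splits-++ (a ∷ as) = refl ∷ All.map⁺ (All.map (cong (a ∷_)) (splits-++ as))

splits-∷ʳ : ∀ (as : List A) a → splits (as ∷ʳ a) ≡ map (map₂ (_∷ʳ a)) (splits as) ∷ʳ (as ∷ʳ a , [])
splits-∷ʳ []       a = refl
splits-∷ʳ (b ∷ as) a = cong (([] , b ∷ as ∷ʳ a) ∷_) (begin
  map (map₁ (b ∷_)) (splits (as ∷ʳ a))
    ≡⟨ cong (map (map₁ (b ∷_))) (splits-∷ʳ as a) ⟩
  map (map₁ (b ∷_)) (map (map₂ (_∷ʳ a)) (splits as) ∷ʳ (as ∷ʳ a , []))
    ≡⟨ map-++ (map₁ (b ∷_)) (map (map₂ (_∷ʳ a)) (splits as)) _ ⟩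
  map (map₁ (b ∷_)) (map (map₂ (_∷ʳ a)) (splits as)) ∷ʳ (b ∷ as ∷ʳ a , [])
    ≡⟨ cong (_∷ʳ (b ∷ as ∷ʳ a , [])) (≡.trans (sym (map-∘ (splits as))) (map-∘ (splits as))) ⟩
  map (map₂ (_∷ʳ a)) (map (map₁ (b ∷_)) (splits as)) ∷ʳ (b ∷ as ∷ʳ a , []) ∎)

reverseSplit : List A × List A → List A × List A
reverseSplit (as , bs) = reverse bs , reverse as

splits-reverse : ∀ (as : List A) → splits (reverse as) ≡ reverse (map reverseSplit (splits as))
splits-reverse []       = refl
splits-reverse (a ∷ as) = begin
  splits (reverse (a ∷ as))
    ≡⟨ cong splits (unfold-reverse a as) ⟩
  splits (reverse as ∷ʳ a)
    ≡⟨ splits-∷ʳ (reverse as) a ⟩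
  map (map₂ (_∷ʳ a)) (splits (reverse as)) ∷ʳ (reverse as ∷ʳ a , [])
    ≡⟨ cong₂ (λ l r → map (map₂ (_∷ʳ a)) l ∷ʳ (r , [])) (splits-reverse as) (sym (unfold-reverse a as)) ⟩
  map (map₂ (_∷ʳ a)) (reverse (map reverseSplit (splits as))) ∷ʳ reverseSplit ([] , a ∷ as)
    ≡⟨ cong (_∷ʳ reverseSplit ([] , a ∷ as)) (reverse-map (map₂ (_∷ʳ a)) (map reverseSplit (splits as))) ⟩
  reverse (map (map₂ (_∷ʳ a)) (map reverseSplit (splits as))) ∷ʳ reverseSplit ([] , a ∷ as)
    ≡⟨ cong (λ l → reverse l ∷ʳ reverseSplit ([] , a ∷ as))
            (≡.trans (sym (map-∘ (splits as))) (≡.trans (map-cong reverse-cons (splits as)) (map-∘ (splits as)))) ⟩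
  reverse (map reverseSplit (map (map₁ (a ∷_)) (splits as))) ∷ʳ reverseSplit ([] , a ∷ as)
    ≡⟨ unfold-reverse (reverseSplit ([] , a ∷ as)) (map reverseSplit (map (map₁ (a ∷_)) (splits as))) ⟨
  reverse (map reverseSplit (splits (a ∷ as))) ∎
  where
  reverse-cons : map₂ (_∷ʳ a) ∘ reverseSplit ≗ reverseSplit ∘ map₁ (a ∷_)
  reverse-cons (bs , cs) = cong (reverse cs ,_) (sym (unfold-reverse a bs))

splits-map : ∀ (g : A → B) as → splits (map g as) ≡ map (×.map (map g) (map g)) (splits as)
splits-map g []       = refl
splits-map g (a ∷ as) = cong (([] , g a ∷ map g as) ∷_)
  (≡.trans (cong (map (map₁ (g a ∷_))) (splits-map g as)) (≡.trans (sym (map-∘ (splits as))) (map-∘ (splits as))))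

∑-splits-reverse : ∀ (h : List A × List A → ℤ) as → ∑ h (splits (reverse as)) ≡ ∑ (h ∘ reverseSplit) (splits as)
∑-splits-reverse h as = begin
  ∑ h (splits (reverse as))                     ≡⟨ cong (∑ h) (splits-reverse as) ⟩
  ∑ h (reverse (map reverseSplit (splits as)))  ≡⟨ ∑-↭ h (↭-reverse (map reverseSplit (splits as))) ⟩
  ∑ h (map reverseSplit (splits as))            ≡⟨ ∑-map h reverseSplit (splits as) ⟩
  ∑ (h ∘ reverseSplit) (splits as)              ∎

nonFinal : (List A × List A → ℤ) → List A × List A → ℤ
nonFinal h (_  , [])     = 0ℤ
nonFinal h (as , b ∷ bs) = h (as , b ∷ bs)

interior : (List A × List A → ℤ) → List A × List A → ℤ
interior h ([]    , _)      = 0ℤ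
interior h (_ ∷ _ , [])     = 0ℤ
interior h (a ∷ as , b ∷ bs) = h (a ∷ as , b ∷ bs)

interior-[]ʳ : ∀ (h : List A × List A → ℤ) as → interior h (as , []) ≡ 0ℤ
interior-[]ʳ h []      = refl
interior-[]ʳ h (_ ∷ _) = refl

interior-nonempty : ∀ (h : List A × List A → ℤ) {as bs : List A} → as ≢ [] → bs ≢ [] →
  interior h (as , bs) ≡ h (as , bs)
interior-nonempty h {[]}    {_}     as≢[] _     = ⊥-elim (as≢[] refl)
interior-nonempty h {_ ∷ _} {[]}    _     bs≢[] = ⊥-elim (bs≢[] refl)
interior-nonempty h {_ ∷ _} {_ ∷ _} _     _     = refl

∑-splits-final : ∀ (h : List A × List A → ℤ) as → ∑ h (splits as) ≡ ∑ (nonFinal h) (splits as) + h (as , [])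
∑-splits-final h []       = ℤ.+-comm (h ([] , [])) 0ℤ
∑-splits-final h (a ∷ as) = begin
  h ([] , a ∷ as) + ∑ h (map (map₁ (a ∷_)) (splits as))
    ≡⟨ cong (λ s → h ([] , a ∷ as) + s) (∑-map h (map₁ (a ∷_)) (splits as)) ⟩
  h ([] , a ∷ as) + ∑ (h ∘ map₁ (a ∷_)) (splits as)
    ≡⟨ cong (λ s → h ([] , a ∷ as) + s) (∑-splits-final (h ∘ map₁ (a ∷_)) as) ⟩
  h ([] , a ∷ as) + (∑ (nonFinal (h ∘ map₁ (a ∷_))) (splits as) + h (a ∷ as , []))
    ≡⟨ cong (λ s → h ([] , a ∷ as) + (s + h (a ∷ as , []))) (∑-cong nonFinal-∷ (splits as)) ⟩
  h ([] , a ∷ as) + (∑ (nonFinal h ∘ map₁ (a ∷_)) (splits as) + h (a ∷ as , []))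
    ≡⟨ ℤ.+-assoc (h ([] , a ∷ as)) _ _ ⟨
  (h ([] , a ∷ as) + ∑ (nonFinal h ∘ map₁ (a ∷_)) (splits as)) + h (a ∷ as , [])
    ≡⟨ cong (λ s → (h ([] , a ∷ as) + s) + h (a ∷ as , [])) (∑-map (nonFinal h) (map₁ (a ∷_)) (splits as)) ⟨
  ∑ (nonFinal h) (splits (a ∷ as)) + h (a ∷ as , []) ∎
  where
  nonFinal-∷ : nonFinal (h ∘ map₁ (a ∷_)) ≗ nonFinal h ∘ map₁ (a ∷_)
  nonFinal-∷ (_ , [])    = refl
  nonFinal-∷ (_ , _ ∷ _) = refl

∑-splits-boundary : ∀ (h : List A × List A → ℤ) a as →
  ∑ h (splits (a ∷ as)) ≡ (h ([] , a ∷ as) + h (a ∷ as , [])) + ∑ (interior h) (splits (a ∷ as))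
∑-splits-boundary {A} h a as = begin
  ∑ h (splits (a ∷ as))
    ≡⟨ ∑-splits-final h (a ∷ as) ⟩
  (h ([] , a ∷ as) + ∑ (nonFinal h) (map (map₁ (a ∷_)) (splits as))) + h (a ∷ as , [])
    ≡⟨ cong (λ s → (h ([] , a ∷ as) + s) + h (a ∷ as , [])) (∑-cong-map (nonFinal h) (interior h) interior-∷) ⟩
  (h ([] , a ∷ as) + ∑ (interior h) (map (map₁ (a ∷_)) (splits as))) + h (a ∷ as , [])
    ≡⟨ ℤ+.xy∙z≈xz∙y (h ([] , a ∷ as)) _ _ ⟩
  (h ([] , a ∷ as) + h (a ∷ as , [])) + ∑ (interior h) (map (map₁ (a ∷_)) (splits as))
    ≡⟨ cong (λ s → (h ([] , a ∷ as) + h (a ∷ as , [])) + s) (ℤ.+-identityˡ _) ⟨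
  (h ([] , a ∷ as) + h (a ∷ as , [])) + ∑ (interior h) (splits (a ∷ as)) ∎
  where
  interior-∷ : ∀ p → nonFinal h (map₁ (a ∷_) p) ≡ interior h (map₁ (a ∷_) p)
  interior-∷ (_ , [])    = refl
  interior-∷ (_ , _ ∷ _) = refl
  ∑-cong-map : ∀ (f g : List A × List A → ℤ) → (∀ p → f (map₁ (a ∷_) p) ≡ g (map₁ (a ∷_) p)) →
    ∑ f (map (map₁ (a ∷_)) (splits as)) ≡ ∑ g (map (map₁ (a ∷_)) (splits as))
  ∑-cong-map f g eq = ≡.trans (∑-map f _ (splits as)) (≡.trans (∑-cong eq (splits as)) (sym (∑-map g _ (splits as))))

-- Insertions and sums over all permutations

plug : A → List A × List A → List A
plug a (as , bs) = as ++ a ∷ bs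

insertions≡map-plug-splits : ∀ y u → insertions y u ≡ map (plug y) (splits u)
insertions≡map-plug-splits y []       = refl
insertions≡map-plug-splits y (x ∷ xs) = cong ((y ∷ x ∷ xs) ∷_) (begin
  map (x ∷_) (insertions y xs)                 ≡⟨ cong (map (x ∷_)) (insertions≡map-plug-splits y xs) ⟩
  map (x ∷_) (map (plug y) (splits xs))        ≡⟨ map-∘ (splits xs) ⟨
  map (plug y ∘ map₁ (x ∷_)) (splits xs)       ≡⟨ map-∘ (splits xs) ⟩
  map (plug y) (map (map₁ (x ∷_)) (splits xs)) ∎)

innerInsertionSum : (List ℕ → ℤ) → ℕ → List ℕ → ℤ
innerInsertionSum f y u = ∑ (interior (f ∘ plug y)) (splits u)

∑-insertions-boundary : ∀ f y x v →
  ∑ f (insertions y (x ∷ v)) ≡ (f (y ∷ x ∷ v) + f (x ∷ v ∷ʳ y)) + innerInsertionSum f y (x ∷ v)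
∑-insertions-boundary f y x v = ≡.trans (cong (∑ f) (insertions≡map-plug-splits y (x ∷ v)))
  (≡.trans (∑-map f (plug y) (splits (x ∷ v))) (∑-splits-boundary (f ∘ plug y) x v))

∑-insertions-reverse : ∀ f x u → ∑ (f ∘ reverse) (insertions x u) ≡ ∑ f (insertions x (reverse u))
∑-insertions-reverse f x u = begin
  ∑ (f ∘ reverse) (insertions x u)              ≡⟨ cong (∑ (f ∘ reverse)) (insertions≡map-plug-splits x u) ⟩
  ∑ (f ∘ reverse) (map (plug x) (splits u))     ≡⟨ ∑-map (f ∘ reverse) (plug x) (splits u) ⟩
  ∑ (f ∘ reverse ∘ plug x) (splits u)           ≡⟨ ∑-cong (λ (xs , ys) → cong f (reverse-++-∷ xs x ys)) (splits u) ⟩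
  ∑ (f ∘ plug x ∘ reverseSplit) (splits u)      ≡⟨ ∑-splits-reverse (f ∘ plug x) u ⟨
  ∑ (f ∘ plug x) (splits (reverse u))           ≡⟨ ∑-map f (plug x) (splits (reverse u)) ⟨
  ∑ f (map (plug x) (splits (reverse u)))       ≡⟨ cong (∑ f) (insertions≡map-plug-splits x (reverse u)) ⟨
  ∑ f (insertions x (reverse u))                ∎

∑-insertions-∷ : ∀ f y z v → ∑ f (insertions y (z ∷ v)) ≡ f (y ∷ z ∷ v) + ∑ (f ∘ (z ∷_)) (insertions y v)
∑-insertions-∷ f y z v = cong (λ s → f (y ∷ z ∷ v) + s) (∑-map f (z ∷_) (insertions y v))

doubleInsertionSum : (List ℕ → ℤ) → ℕ → ℕ → List ℕ → ℤ
doubleInsertionSum f x y u = ∑ (λ v → ∑ f (insertions y v)) (insertions x u)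

-- Apart from the last one, the terms on the right are visibly symmetric in x and y.
doubleInsertionSum-∷ : ∀ f x y z zs → doubleInsertionSum f x y (z ∷ zs) ≡
  (f (y ∷ x ∷ z ∷ zs) + f (x ∷ y ∷ z ∷ zs))
    + (∑ (λ v → f (x ∷ z ∷ v)) (insertions y zs) + ∑ (λ v → f (y ∷ z ∷ v)) (insertions x zs))
    + doubleInsertionSum (f ∘ (z ∷_)) x y zs
doubleInsertionSum-∷ f x y z zs = begin
  doubleInsertionSum f x y (z ∷ zs)
    ≡⟨ ∑-insertions-∷ (λ v → ∑ f (insertions y v)) x z zs ⟩
  ∑ f (insertions y (x ∷ z ∷ zs)) + ∑ (λ v → ∑ f (insertions y (z ∷ v))) (insertions x zs)
    ≡⟨ cong₂ _+_ (∑-insertions-∷ f y x (z ∷ zs)) (∑-cong (λ v → ∑-insertions-∷ f y z v) (insertions x zs)) ⟩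
  (f (y ∷ x ∷ z ∷ zs) + ∑ (f ∘ (x ∷_)) (insertions y (z ∷ zs)))
    + ∑ (λ v → f (y ∷ z ∷ v) + ∑ (f ∘ (z ∷_)) (insertions y v)) (insertions x zs)
    ≡⟨ cong₂ _+_ (cong (λ s → f (y ∷ x ∷ z ∷ zs) + s) (∑-insertions-∷ (f ∘ (x ∷_)) y z zs))
                 (∑-+ (λ v → f (y ∷ z ∷ v)) (λ v → ∑ (f ∘ (z ∷_)) (insertions y v)) (insertions x zs)) ⟩
  (f (y ∷ x ∷ z ∷ zs) + (f (x ∷ y ∷ z ∷ zs) + ∑ (λ v → f (x ∷ z ∷ v)) (insertions y zs)))
    + (∑ (λ v → f (y ∷ z ∷ v)) (insertions x zs) + doubleInsertionSum (f ∘ (z ∷_)) x y zs)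
    ≡⟨ solve 5 (λ a b c d e → (a :+ (b :+ c)) :+ (d :+ e) := ((a :+ b) :+ (c :+ d)) :+ e) refl
         (f (y ∷ x ∷ z ∷ zs)) (f (x ∷ y ∷ z ∷ zs)) (∑ (λ v → f (x ∷ z ∷ v)) (insertions y zs))
         (∑ (λ v → f (y ∷ z ∷ v)) (insertions x zs)) (doubleInsertionSum (f ∘ (z ∷_)) x y zs) ⟩
  (f (y ∷ x ∷ z ∷ zs) + f (x ∷ y ∷ z ∷ zs))
    + (∑ (λ v → f (x ∷ z ∷ v)) (insertions y zs) + ∑ (λ v → f (y ∷ z ∷ v)) (insertions x zs))
    + doubleInsertionSum (f ∘ (z ∷_)) x y zs ∎
  where open +-*-Solver

doubleInsertionSum-comm : ∀ f x y u → doubleInsertionSum f x y u ≡ doubleInsertionSum f y x u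
doubleInsertionSum-comm f x y [] =
  cong (_+ 0ℤ) (ℤ+.x∙yz≈y∙xz (f (y ∷ x ∷ [])) (f (x ∷ y ∷ [])) 0ℤ)
doubleInsertionSum-comm f x y (z ∷ zs) = begin
  doubleInsertionSum f x y (z ∷ zs)
    ≡⟨ doubleInsertionSum-∷ f x y z zs ⟩
  (f (y ∷ x ∷ z ∷ zs) + f (x ∷ y ∷ z ∷ zs))
    + (∑ (λ v → f (x ∷ z ∷ v)) (insertions y zs) + ∑ (λ v → f (y ∷ z ∷ v)) (insertions x zs))
    + doubleInsertionSum (f ∘ (z ∷_)) x y zs
    ≡⟨ cong₂ _+_ (cong₂ _+_ (ℤ.+-comm (f (y ∷ x ∷ z ∷ zs)) _)
                            (ℤ.+-comm (∑ (λ v → f (x ∷ z ∷ v)) (insertions y zs)) _))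
                 (doubleInsertionSum-comm (f ∘ (z ∷_)) x y zs) ⟩
  (f (x ∷ y ∷ z ∷ zs) + f (y ∷ x ∷ z ∷ zs))
    + (∑ (λ v → f (y ∷ z ∷ v)) (insertions x zs) + ∑ (λ v → f (x ∷ z ∷ v)) (insertions y zs))
    + doubleInsertionSum (f ∘ (z ∷_)) y x zs
    ≡⟨ doubleInsertionSum-∷ f y x z zs ⟨
  doubleInsertionSum f y x (z ∷ zs) ∎

∑-perms-↭ : xs ↭ ys → ∀ f → ∑ f (perms xs) ≡ ∑ f (perms ys)
∑-perms-↭ refl f = refl
∑-perms-↭ (prep {xs} {ys} x p) f = begin
  ∑ f (perms (x ∷ xs))                          ≡⟨ ∑-concatMap f (insertions x) (perms xs) ⟩
  ∑ (λ u → ∑ f (insertions x u)) (perms xs)     ≡⟨ ∑-perms-↭ p (λ u → ∑ f (insertions x u)) ⟩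
  ∑ (λ u → ∑ f (insertions x u)) (perms ys)     ≡⟨ ∑-concatMap f (insertions x) (perms ys) ⟨
  ∑ f (perms (x ∷ ys))                          ∎
∑-perms-↭ (swap {xs} {ys} x y p) f = begin
  ∑ f (perms (x ∷ y ∷ xs))
    ≡⟨ ∑-concatMap f (insertions x) (perms (y ∷ xs)) ⟩
  ∑ (λ v → ∑ f (insertions x v)) (concatMap (insertions y) (perms xs))
    ≡⟨ ∑-concatMap (λ v → ∑ f (insertions x v)) (insertions y) (perms xs) ⟩
  ∑ (λ u → ∑ (λ v → ∑ f (insertions x v)) (insertions y u)) (perms xs)
    ≡⟨ ∑-cong (doubleInsertionSum-comm f y x) (perms xs) ⟩
  ∑ (λ u → ∑ (λ v → ∑ f (insertions y v)) (insertions x u)) (perms xs)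
    ≡⟨ ∑-perms-↭ p (λ u → ∑ (λ v → ∑ f (insertions y v)) (insertions x u)) ⟩
  ∑ (λ u → ∑ (λ v → ∑ f (insertions y v)) (insertions x u)) (perms ys)
    ≡⟨ ∑-concatMap (λ v → ∑ f (insertions y v)) (insertions x) (perms ys) ⟨
  ∑ (λ v → ∑ f (insertions y v)) (concatMap (insertions x) (perms ys))
    ≡⟨ ∑-concatMap f (insertions y) (perms (x ∷ ys)) ⟨
  ∑ f (perms (y ∷ x ∷ ys)) ∎
∑-perms-↭ (trans p q) f = ≡.trans (∑-perms-↭ p f) (∑-perms-↭ q f)

insertions-map : ∀ (g : ℕ → ℕ) x u → insertions (g x) (map g u) ≡ map (map g) (insertions x u)
insertions-map g x []       = refl
insertions-map g x (y ∷ ys) = cong ((g x ∷ g y ∷ map g ys) ∷_)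
  (≡.trans (cong (map (g y ∷_)) (insertions-map g x ys))
           (≡.trans (sym (map-∘ (insertions x ys))) (map-∘ (insertions x ys))))

perms-map : ∀ (g : ℕ → ℕ) xs → perms (map g xs) ≡ map (map g) (perms xs)
perms-map g []       = refl
perms-map g (x ∷ xs) = begin
  concatMap (insertions (g x)) (perms (map g xs))        ≡⟨ cong (concatMap (insertions (g x))) (perms-map g xs) ⟩
  concatMap (insertions (g x)) (map (map g) (perms xs))  ≡⟨ concatMap-map (insertions (g x)) (map g) (perms xs) ⟩
  concatMap (insertions (g x) ∘ map g) (perms xs)        ≡⟨ concatMap-cong (insertions-map g x) (perms xs) ⟩
  concatMap (map (map g) ∘ insertions x) (perms xs)      ≡⟨ map-concatMap (map g) (insertions x) (perms xs) ⟨
  map (map g) (concatMap (insertions x) (perms xs))      ∎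

∑-perms-reverse : ∀ xs f → ∑ (f ∘ reverse) (perms xs) ≡ ∑ f (perms xs)
∑-perms-reverse []       f = refl
∑-perms-reverse (x ∷ xs) f = begin
  ∑ (f ∘ reverse) (perms (x ∷ xs))                       ≡⟨ ∑-concatMap (f ∘ reverse) (insertions x) (perms xs) ⟩
  ∑ (λ u → ∑ (f ∘ reverse) (insertions x u)) (perms xs)  ≡⟨ ∑-cong (∑-insertions-reverse f x) (perms xs) ⟩
  ∑ (λ u → ∑ f (insertions x (reverse u))) (perms xs)    ≡⟨ ∑-perms-reverse xs (λ u → ∑ f (insertions x u)) ⟩
  ∑ (λ u → ∑ f (insertions x u)) (perms xs)              ≡⟨ ∑-concatMap f (insertions x) (perms xs) ⟨
  ∑ f (perms (x ∷ xs))                                   ∎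

∑-perms-reverse-map : ∀ (g : ℕ → ℕ) xs → map g xs ↭ xs → ∀ f →
  ∑ (λ u → f (reverse (map g u))) (perms xs) ≡ ∑ f (perms xs)
∑-perms-reverse-map g xs p f = begin
  ∑ (λ u → f (reverse (map g u))) (perms xs)   ≡⟨ ∑-map (f ∘ reverse) (map g) (perms xs) ⟨
  ∑ (f ∘ reverse) (map (map g) (perms xs))     ≡⟨ cong (∑ (f ∘ reverse)) (perms-map g xs) ⟨
  ∑ (f ∘ reverse) (perms (map g xs))           ≡⟨ ∑-perms-reverse (map g xs) f ⟩
  ∑ f (perms (map g xs))                       ≡⟨ ∑-perms-↭ p f ⟩
  ∑ f (perms xs)                               ∎

insertions-↭ : ∀ x u → All (_↭ x ∷ u) (insertions x u)
insertions-↭ x []       = refl ∷ []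
insertions-↭ x (y ∷ ys) = refl ∷ All.map⁺ (All.map (λ p → trans (prep y p) (swap y x refl)) (insertions-↭ x ys))

perms-↭ : ∀ xs → All (_↭ xs) (perms xs)
perms-↭ []       = refl ∷ []
perms-↭ (x ∷ xs) = All.concat⁺ (All.map⁺ (All.map insertions-of-↭ (perms-↭ xs)))
  where
  insertions-of-↭ : ∀ {u} → u ↭ xs → All (_↭ x ∷ xs) (insertions x u)
  insertions-of-↭ {u} u↭xs = All.map (λ p → trans p (prep x u↭xs)) (insertions-↭ x u)

-- The recurrence

∑-insertions-max : isEven m ≡ false → u ↭ range1 m →
  ∑ (weight (suc k)) (insertions (suc m) u)
    ≡ (weight k u - weight (suc k) u) + innerInsertionSum (weight (suc k)) (suc m) u
∑-insertions-max {m} {[]}    m-odd p = ⊥-elim (↭-range1-≢[] m-odd p refl)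
∑-insertions-max {m} {x ∷ v} {k} m-odd p = begin
  ∑ (weight (suc k)) (insertions (suc m) (x ∷ v))
    ≡⟨ ∑-insertions-boundary (weight (suc k)) (suc m) x v ⟩
  (weight (suc k) (suc m ∷ x ∷ v) + weight (suc k) (x ∷ v ∷ʳ suc m)) + J
    ≡⟨ cong (_+ J) (cong₂ _+_ (weight-max-∷ m-odd p) (weight-∷ʳ-max m-odd p)) ⟩
  (- weight (suc k) (x ∷ v) + weight k (x ∷ v)) + J
    ≡⟨ cong (_+ J) (ℤ.+-comm (- weight (suc k) (x ∷ v)) (weight k (x ∷ v))) ⟩
  (weight k (x ∷ v) - weight (suc k) (x ∷ v)) + J ∎
  where
  J : ℤ
  J = innerInsertionSum (weight (suc k)) (suc m) (x ∷ v)

innerInsertionSum-reverseComplement : isEven m ≡ false → u ↭ range1 m →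
  innerInsertionSum (weight k) (suc m) (reverseComplement (suc m) u) ≡ - innerInsertionSum (weight k) (suc m) u
innerInsertionSum-reverseComplement {m} {u} {k} m-odd p = begin
  ∑ (interior h) (splits (reverse (map (suc m ∸_) u)))
    ≡⟨ ∑-splits-reverse (interior h) (map (suc m ∸_) u) ⟩
  ∑ (interior h ∘ reverseSplit) (splits (map (suc m ∸_) u))
    ≡⟨ cong (∑ (interior h ∘ reverseSplit)) (splits-map (suc m ∸_) u) ⟩
  ∑ (interior h ∘ reverseSplit) (map (×.map (map (suc m ∸_)) (map (suc m ∸_))) (splits u))
    ≡⟨ ∑-map (interior h ∘ reverseSplit) (×.map (map (suc m ∸_)) (map (suc m ∸_))) (splits u) ⟩
  ∑ (λ (xs , ys) → interior h (reverseComplement (suc m) ys , reverseComplement (suc m) xs)) (splits u)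
    ≡⟨ ∑-cong-All (splits-++ u) (λ {s} → flip-split (proj₁ s) (proj₂ s)) ⟩
  ∑ (λ s → - interior h s) (splits u)
    ≡⟨ ∑-neg (interior h) (splits u) ⟩
  - ∑ (interior h) (splits u) ∎
  where
  h : List ℕ × List ℕ → ℤ
  h = weight k ∘ plug (suc m)
  flip-split : ∀ xs ys → xs ++ ys ≡ u →
    interior h (reverseComplement (suc m) ys , reverseComplement (suc m) xs) ≡ - interior h (xs , ys)
  flip-split []       ys       _  = interior-[]ʳ h (reverseComplement (suc m) ys)
  flip-split (_ ∷ _)  []       _  = refl
  flip-split (x ∷ xs) (y ∷ ys) eq =
    ≡.trans (interior-nonempty h (reverseComplement-≢[] (suc m) (y ∷ ys) λ ())
                                 (reverseComplement-≢[] (suc m) (x ∷ xs) λ ()))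
            (weight-flip {m} {x ∷ xs} {y ∷ ys} {k} m-odd (subst (_↭ range1 m) (sym eq) p) (λ ()) (λ ()))

∑-innerInsertionSum-vanishes : isEven m ≡ false → ∑ (innerInsertionSum (weight k) (suc m)) (perms (range1 m)) ≡ 0ℤ
∑-innerInsertionSum-vanishes {m} {k} m-odd = i≡-i⇒i≡0 _ (begin
  ∑ J (perms (range1 m))
    ≡⟨ ∑-perms-reverse-map (suc m ∸_) (range1 m) complement-↭ J ⟨
  ∑ (J ∘ reverseComplement (suc m)) (perms (range1 m))
    ≡⟨ ∑-cong-All (perms-↭ (range1 m)) (innerInsertionSum-reverseComplement m-odd) ⟩
  ∑ (λ u → - J u) (perms (range1 m))
    ≡⟨ ∑-neg J (perms (range1 m)) ⟩
  - ∑ J (perms (range1 m)) ∎)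
  where
  J : List ℕ → ℤ
  J = innerInsertionSum (weight k) (suc m)
  complement-↭ : map (suc m ∸_) (range1 m) ↭ range1 m
  complement-↭ = trans (↭-reflexive (complement-range1 m)) (↭-reverse (range1 m))

R-recurrence : isEven m ≡ false → R (suc m) (suc k) ≡ R m k - R m (suc k)
R-recurrence {m} {k} m-odd = begin
  R (suc m) (suc k)
    ≡⟨ R≡∑weight (suc m) (suc k) ⟩
  ∑ (weight (suc k)) (perms (range1 (suc m)))
    ≡⟨ ∑-perms-↭ max-first (weight (suc k)) ⟩
  ∑ (weight (suc k)) (perms (suc m ∷ range1 m))
    ≡⟨ ∑-concatMap (weight (suc k)) (insertions (suc m)) (perms (range1 m)) ⟩
  ∑ (λ u → ∑ (weight (suc k)) (insertions (suc m) u)) (perms (range1 m))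
    ≡⟨ ∑-cong-All (perms-↭ (range1 m)) (∑-insertions-max m-odd) ⟩
  ∑ (λ u → (weight k u - weight (suc k) u) + J u) (perms (range1 m))
    ≡⟨ ∑-+ (λ u → weight k u - weight (suc k) u) J (perms (range1 m)) ⟩
  ∑ (λ u → weight k u - weight (suc k) u) (perms (range1 m)) + ∑ J (perms (range1 m))
    ≡⟨ cong₂ _+_ (∑-+ (weight k) (λ u → - weight (suc k) u) (perms (range1 m)))
                 (∑-innerInsertionSum-vanishes {m} {suc k} m-odd) ⟩
  (∑ (weight k) (perms (range1 m)) + ∑ (λ u → - weight (suc k) u) (perms (range1 m))) + 0ℤ
    ≡⟨ ℤ.+-identityʳ _ ⟩
  ∑ (weight k) (perms (range1 m)) + ∑ (λ u → - weight (suc k) u) (perms (range1 m))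
    ≡⟨ cong₂ _+_ (R≡∑weight m k)
                 (≡.trans (cong -_ (R≡∑weight m (suc k))) (sym (∑-neg (weight (suc k)) (perms (range1 m))))) ⟨
  R m k - R m (suc k) ∎
  where
  J : List ℕ → ℤ
  J = innerInsertionSum (weight (suc k)) (suc m)
  max-first : range1 (suc m) ↭ suc m ∷ range1 m
  max-first = trans (↭-reflexive (range1-suc m)) (↭-sym (∷↭∷ʳ (suc m) (range1 m)))

theorem4p1 : (n k : ℕ) → 1 ≤ n → 2 ∣ n → 1 ≤ k → k ≤ n ∸ 2 →
    R n k ≡ R (n ∸ 1) (k ∸ 1) - R (n ∸ 1) k
theorem4p1 zero    _       ()  _   _  _
theorem4p1 (suc m) zero    _   _   () _
theorem4p1 (suc m) (suc k) _   2∣n _  _ = R-recurrence {m} {k} (2∣suc⇒odd 2∣n)
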